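{- Let $G$ be a connected graph of order $n\ge 2$ in which no two distinct vertices are twins, and let $\mathcal{H}=\{H_1,\ldots,H_n\}$ be a family of $n$ non-trivial graphs. Then $G\circ\mathcal{H}$ is $\mathcal{C}(\mathcal{H})$-metric dimensional.
   Context: All graphs are finite and simple; non-trivial means at least two vertices. Distinct vertices $x,y$ are twins if $N(x)=N(y)$ or $N[x]=N[y]$. With $V(G)=\{u_1,\ldots,u_n\}$, the lexicographic product $G\circ\mathcal{H}$ has vertex set $\bigcup_i\{u_i\}\times V(H_i)$, with $(u_i,v)\sim(u_j,w)$ iff $u_iu_j\in E(G)$, or $i=j$ and $vw\in E(H_i)$. A connected graph $X$ is $k$-metric dimensional if $k$ is the largest integer for which there is a set $S\subseteq V(X)$ such that every two distinct vertices $x,y$ admit at least $k$ vertices $w\in S$ with $d_X(x,w)\neq d_X(y,w)$. For a graph $H$, $\mathcal{C}(H)=\min_{x\neq y}|(N_H(x)\triangledown N_H(y))\cup\{x,y\}|$ ($\triangledown$ = symmetric difference), and $\mathcal{C}(\mathcal{H})=\min_i\mathcal{C}(H_i)$. -}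

module Defs where

open import Data.Nat using (ℕ; zero; suc; _≤_; _<_)
open import Data.Fin using (Fin; _≟_)
open import Data.Bool using (Bool; T; _∨_; _xor_)
open import Data.List using (List; length; filterᵇ; allFin)
open import Data.List.Membership.Propositional using (_∈_)
open import Data.List.Relation.Unary.All using (All)
open import Data.List.Relation.Unary.Unique.Propositional using (Unique)
open import Data.Product using (Σ; ∃; ∃-syntax; _×_; _,_)
open import Data.Sum using (_⊎_)
open import Relation.Binary.PropositionalEquality using (_≡_; _≢_; subst)
open import Relation.Nullary using (¬_; does)
open import Function.Bundles using (_⇔_)

record Graph (V : Set) : Set₁ where
  field
    Adj    : V → V → Set
    sym    : ∀ {x y} → Adj x y → Adj y x
    irrefl : ∀ {x} → ¬ Adj x x
open Graph public

record FinGraph (n : ℕ) : Set where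
  field
    adj        : Fin n → Fin n → Bool
    adj-sym    : ∀ x y → adj x y ≡ adj y x
    adj-irrefl : ∀ x → ¬ T (adj x x)
open FinGraph public

toGraph : ∀ {n} → FinGraph n → Graph (Fin n)
toGraph G = record
  { Adj    = λ x y → T (adj G x y)
  ; sym    = λ {x} {y} p → subst T (adj-sym G x y) p
  ; irrefl = λ {x} → adj-irrefl G x
  }

data Walk {V : Set} (G : Graph V) : V → V → ℕ → Set where
  here : ∀ {x} → Walk G x x zero
  step : ∀ {x z y k} → Adj G x z → Walk G z y k → Walk G x y (suc k)

Dist : ∀ {V : Set} → Graph V → V → V → ℕ → Set
Dist G x y d = Walk G x y d × (∀ k → Walk G x y k → d ≤ k)

Connected : ∀ {V : Set} → Graph V → Set
Connected G = ∀ x y → ∃[ k ] Walk G x y k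

Distinguishes : ∀ {V : Set} → Graph V → V → V → V → Set
Distinguishes G w x y = ∀ a b → Dist G x w a → Dist G y w b → a ≢ b

IsKMetricGenerator : ∀ {V : Set} → Graph V → List V → ℕ → Set
IsKMetricGenerator {V} G S k =
  ∀ (x y : V) → x ≢ y →
    Σ (List V) λ T → Unique T × All (_∈ S) T × k ≤ length T
                   × All (λ w → Distinguishes G w x y) T

KMetricDimensional : ∀ {V : Set} → Graph V → ℕ → Set
KMetricDimensional {V} G k =
  Connected G
  × (Σ (List V) λ S → IsKMetricGenerator G S k)
  × (∀ k′ → k < k′ → ¬ (Σ (List V) λ S → IsKMetricGenerator G S k′))

Twins : ∀ {V : Set} → Graph V → V → V → Set
Twins G x y =
  (∀ z → Adj G x z ⇔ Adj G y z)
  ⊎ (∀ z → (z ≡ x ⊎ Adj G x z) ⇔ (z ≡ y ⊎ Adj G y z))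

TwinFree : ∀ {V : Set} → Graph V → Set
TwinFree {V} G = ∀ (x y : V) → x ≢ y → ¬ Twins G x y

LexV : (n : ℕ) → (Fin n → ℕ) → Set
LexV n m = Σ (Fin n) λ i → Fin (m i)

data LexAdj {n : ℕ} {m : Fin n → ℕ} (G : FinGraph n)
            (H : (i : Fin n) → FinGraph (m i)) : LexV n m → LexV n m → Set where
  outer : ∀ {i j v w} → T (adj G i j) → LexAdj G H (i , v) (j , w)
  inner : ∀ {i v w} → T (adj (H i) v w) → LexAdj G H (i , v) (i , w)

lexSym : ∀ {n m G H} {p q : LexV n m} → LexAdj {n} {m} G H p q → LexAdj G H q p
lexSym {G = G} (outer {i} {j} e) = outer (subst T (adj-sym G i j) e)
lexSym {H = H} (inner {i} {v} {w} e) = inner (subst T (adj-sym (H i) v w) e)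

lexIrrefl : ∀ {n m G H} {p : LexV n m} → ¬ LexAdj {n} {m} G H p p
lexIrrefl {G = G} (outer {i} e) = adj-irrefl G i e
lexIrrefl {H = H} (inner {i} {v} e) = adj-irrefl (H i) v e

Lex : ∀ {n} {m : Fin n → ℕ} → FinGraph n → ((i : Fin n) → FinGraph (m i))
    → Graph (LexV n m)
Lex G H = record { Adj = LexAdj G H ; sym = lexSym ; irrefl = lexIrrefl }

cSize : ∀ {m} → FinGraph m → Fin m → Fin m → ℕ
cSize {m} H x y =
  length (filterᵇ (λ z → does (z ≟ x) ∨ does (z ≟ y) ∨ (adj H x z xor adj H y z))
                  (allFin m))

-- c = C(ℋ) = min_i C(H_i) = min over all i and all x ≠ y in H_i of cSize
IsCFamily : ∀ {n} {m : Fin n → ℕ} → ((i : Fin n) → FinGraph (m i)) → ℕ → Set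
IsCFamily {n} {m} H c =
  (Σ (Fin n) λ i → Σ (Fin (m i)) λ x → Σ (Fin (m i)) λ y → x ≢ y × cSize (H i) x y ≡ c)
  × (∀ i (x y : Fin (m i)) → x ≢ y → c ≤ cSize (H i) x y)

module Submission where

-- In G ∘ ℋ two vertices in different layers i ≠ j are at distance d_G(i, j), whatever
-- their coordinates, while two vertices (i, v), (i, u) of one layer are at distance 0, 1
-- or 2 according as u = v, v ~ u in H_i, or neither (a neighbour of i in G provides a
-- path of length 2).  Hence a vertex resolves (i, x) and (i, y) exactly when it lies in
-- layer i with its coordinate in (N(x) ▽ N(y)) ∪ {x, y}, so no pair can be resolved by
-- more than 𝒞(ℋ) vertices.  Conversely, for vertices in distinct layers i, j, twin-freeness
-- of G yields a layer z ∉ {i, j} adjacent to exactly one of i and j, and all of layer z,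
-- at least 𝒞(ℋ) vertices, resolves them.

open import Defs hiding (sym)
open import Data.Nat using (ℕ; zero; suc; _≤_; _<_; z≤n; s≤s)
open import Data.Nat.Induction using (<-rec)
open import Data.Nat.Properties
  using (≤-antisym; ≤-trans; ≤-reflexive; ≮⇒≥; m≤n⇒m≤1+n; <-irrefl; anyUpTo?)
open import Data.Fin using (Fin; zero; suc; _≟_)
open import Data.Fin.Properties using (any?; ¬∀⟶∃¬)
open import Data.Bool using (Bool; true; false; T; _∨_; _xor_; if_then_else_)
import Data.Bool.Properties as Bool
open import Data.Unit using (tt)
open import Data.Empty using (⊥-elim)
open import Data.List using (List; []; _∷_; length; map; concat; filterᵇ; allFin)
open import Data.List.Properties using (length-map; length-filter; length-tabulate; length-removeAt′)
open import Data.List.Relation.Unary.Any using (here; there; index; _─_)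
open import Data.List.Relation.Unary.All as All using (All; []; _∷_)
import Data.List.Relation.Unary.All.Properties as All
open import Data.List.Relation.Unary.AllPairs using ([]; _∷_)
open import Data.List.Membership.Propositional using (_∈_)
open import Data.List.Membership.Propositional.Properties
  using (∈-allFin; ∈-map⁺; ∈-filter⁺; ∈-concat⁺′)
open import Data.List.Relation.Unary.Unique.Propositional using (Unique)
import Data.List.Relation.Unary.Unique.Propositional.Properties as Unique
open import Data.Product using (Σ; ∃-syntax; _×_; _,_; proj₁; proj₂)
open import Data.Sum using (_⊎_; inj₁; inj₂)
open import Function using (_∘_)
open import Function.Bundles using (mk⇔)
open import Relation.Binary.PropositionalEquality
  using (_≡_; _≢_; refl; sym; trans; subst; cong)
open import Relation.Nullary using (¬_; Dec; yes; no; does)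
open import Relation.Nullary.Decidable using (T?; decidable-stable; _×-dec_; _⊎-dec_)

module _ {V : Set} {G : Graph V} where

  walk-zero⇒≡ : ∀ {x y} → Walk G x y 0 → x ≡ y
  walk-zero⇒≡ here = refl

  Dist-unique : ∀ {x y a b} → Dist G x y a → Dist G x y b → a ≡ b
  Dist-unique (wa , a-min) (wb , b-min) = ≤-antisym (a-min _ wb) (b-min _ wa)

  Distinguishes-sym : ∀ {w x y} → Distinguishes G w x y → Distinguishes G w y x
  Distinguishes-sym d a b da db a≡b = d b a db da (sym a≡b)

least-witness : {P : ℕ → Set} → (∀ k → Dec (P k)) →
                ∀ k → P k → ∃[ d ] P d × (∀ j → P j → d ≤ j)
least-witness {P} P? = <-rec _ least
  where
  least : ∀ k → (∀ {j} → j < k → P j → ∃[ d ] P d × (∀ i → P i → d ≤ i)) →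
          P k → ∃[ d ] P d × (∀ i → P i → d ≤ i)
  least k smaller Pk with anyUpTo? P? k
  ... | yes (j , j<k , Pj) = smaller j<k Pj
  ... | no none = k , Pk , λ j Pj → ≮⇒≥ (λ j<k → none (j , j<k , Pj))

module _ {n} (G : FinGraph n) where

  walk? : ∀ k x y → Dec (Walk (toGraph G) x y k)
  walk? zero x y with x ≟ y
  ... | yes refl = yes here
  ... | no x≢y = no (x≢y ∘ walk-zero⇒≡)
  walk? (suc k) x y with any? (λ z → T? (adj G x z) ×-dec walk? k z y)
  ... | yes (z , e , w) = yes (step e w)
  ... | no ¬w = no λ { (step {z = z} e w) → ¬w (z , e , w) }

  Dist-exists : ∀ {x y k} → Walk (toGraph G) x y k → ∃[ d ] Dist (toGraph G) x y d
  Dist-exists {x} {y} {k} = least-witness (λ d → walk? d x y) k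

  connected⇒neighbour : 2 ≤ n → Connected (toGraph G) → ∀ i → ∃[ j ] T (adj G i j)
  connected⇒neighbour 2≤n conn i with another 2≤n i
    where
    another : ∀ {k} → 2 ≤ k → (i : Fin k) → ∃[ j ] j ≢ i
    another (s≤s (s≤s _)) zero    = suc zero , λ ()
    another (s≤s (s≤s _)) (suc i) = zero , λ ()
  ... | j , j≢i with conn i j
  ...   | _ , here = ⊥-elim (j≢i refl)
  ...   | _ , step {z = z} e _ = z , e

∈-─ : {A : Set} {x y : A} {xs : List A} (x∈xs : x ∈ xs) → y ∈ xs → y ≢ x → y ∈ (xs ─ x∈xs)
∈-─ (here refl) (here refl) y≢x = ⊥-elim (y≢x refl)
∈-─ (here _)    (there y∈)  _   = y∈
∈-─ (there _)   (here refl) _   = here refl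
∈-─ (there x∈)  (there y∈)  y≢x = there (∈-─ x∈ y∈ y≢x)

Unique⇒length≤ : {A : Set} {xs ys : List A} → Unique xs → All (_∈ ys) xs → length xs ≤ length ys
Unique⇒length≤ [] [] = z≤n
Unique⇒length≤ {ys = ys} (x∉xs ∷ u) (x∈ys ∷ xs⊆ys) =
  subst (_ ≤_) (sym (length-removeAt′ ys (index x∈ys)))
        (s≤s (Unique⇒length≤ u (All.zipWith (λ (y∈ys , x≢y) → ∈-─ x∈ys y∈ys (x≢y ∘ sym))
                                             (xs⊆ys , x∉xs))))

module _ {n} (G : FinGraph n) where

  adj-self : ∀ x → adj G x x ≡ false
  adj-self x with adj G x x in x~x
  ... | false = refl
  ... | true  = ⊥-elim (adj-irrefl G x (subst T (sym x~x) tt))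

  agree⇒Twins : ∀ {i j} → (∀ z → z ≡ i ⊎ z ≡ j ⊎ adj G i z ≡ adj G j z) → Twins (toGraph G) i j
  agree⇒Twins {i} {j} agree with adj G i j in i~j
  ... | false = inj₁ λ z → mk⇔ (subst T (same z)) (subst T (sym (same z)))
    where
    same : ∀ z → adj G i z ≡ adj G j z
    same z with agree z
    ... | inj₁ refl        = trans (adj-self i) (trans (sym i~j) (adj-sym G i j))
    ... | inj₂ (inj₁ refl) = trans i~j (sym (adj-self j))
    ... | inj₂ (inj₂ e)    = e
  ... | true = inj₂ λ z → mk⇔ (to z) (from z)
    where
    to : ∀ z → z ≡ i ⊎ T (adj G i z) → z ≡ j ⊎ T (adj G j z)
    to z (inj₁ refl) = inj₂ (subst T (sym (trans (adj-sym G j i) i~j)) tt)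
    to z (inj₂ t) with agree z
    ... | inj₁ refl        = ⊥-elim (adj-irrefl G i t)
    ... | inj₂ (inj₁ refl) = inj₁ refl
    ... | inj₂ (inj₂ e)    = inj₂ (subst T e t)
    from : ∀ z → z ≡ j ⊎ T (adj G j z) → z ≡ i ⊎ T (adj G i z)
    from z (inj₁ refl) = inj₂ (subst T (sym i~j) tt)
    from z (inj₂ t) with agree z
    ... | inj₁ refl        = inj₁ refl
    ... | inj₂ (inj₁ refl) = ⊥-elim (adj-irrefl G j t)
    ... | inj₂ (inj₂ e)    = inj₂ (subst T (sym e) t)

  ¬Twins⇒separator : ∀ {i j} → ¬ Twins (toGraph G) i j →
                     ∃[ z ] z ≢ i × z ≢ j × adj G i z ≢ adj G j z
  ¬Twins⇒separator {i} {j} ¬twins with ¬∀⟶∃¬ n _ agrees? (¬twins ∘ agree⇒Twins)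
    where
    agrees? : ∀ z → Dec (z ≡ i ⊎ z ≡ j ⊎ adj G i z ≡ adj G j z)
    agrees? z = (z ≟ i) ⊎-dec (z ≟ j) ⊎-dec (adj G i z Bool.≟ adj G j z)
  ... | z , ¬agree = z , ¬agree ∘ inj₁ , ¬agree ∘ inj₂ ∘ inj₁ , ¬agree ∘ inj₂ ∘ inj₂

module _ {m} (H : FinGraph m) where

  cMember : Fin m → Fin m → Fin m → Bool
  cMember x y z = does (z ≟ x) ∨ does (z ≟ y) ∨ (adj H x z xor adj H y z)

  -- d_{G∘ℋ}((i, v), (i, u)) when layer i has a neighbouring layer.
  innerDist : Fin m → Fin m → ℕ
  innerDist v u = if does (u ≟ v) then 0 else (if adj H v u then 1 else 2)

  innerDist-≢ : ∀ {x y} z → x ≢ y → T (cMember x y z) → innerDist x z ≢ innerDist y z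
  innerDist-≢ {x} {y} z x≢y t with z ≟ x | z ≟ y | adj H x z | adj H y z
  ... | yes refl | yes refl | _     | _     = ⊥-elim (x≢y refl)
  ... | yes _    | no _     | _     | true  = λ ()
  ... | yes _    | no _     | _     | false = λ ()
  ... | no _     | yes _    | true  | _     = λ ()
  ... | no _     | yes _    | false | _     = λ ()
  ... | no _     | no _     | true  | false = λ ()
  ... | no _     | no _     | false | true  = λ ()

  innerDist-≡ : ∀ {x y} z → ¬ T (cMember x y z) → innerDist x z ≡ innerDist y z
  innerDist-≡ {x} {y} z ¬t with z ≟ x | z ≟ y | adj H x z | adj H y z
  ... | yes _ | _     | _     | _     = ⊥-elim (¬t tt)
  ... | no _  | yes _ | _     | _     = ⊥-elim (¬t tt)
  ... | no _  | no _  | true  | false = ⊥-elim (¬t tt)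
  ... | no _  | no _  | false | true  = ⊥-elim (¬t tt)
  ... | no _  | no _  | true  | true  = refl
  ... | no _  | no _  | false | false = refl

  cSize≤order : ∀ x y → cSize H x y ≤ m
  cSize≤order x y = ≤-trans (length-filter (T? ∘ cMember x y) (allFin m))
                            (≤-reflexive (length-tabulate {n = m} (λ z → z)))

module LexProduct {n} {m : Fin n → ℕ} (G : FinGraph n) (H : (i : Fin n) → FinGraph (m i)) where

  L : Graph (LexV n m)
  L = Lex G H

  inLayer : (i : Fin n) → Fin (m i) → LexV n m
  inLayer i v = i , v

  layer-injective : ∀ {i} {v u : Fin (m i)} → _≡_ {A = LexV n m} (i , v) (i , u) → v ≡ u
  layer-injective refl = refl

  layer : (i : Fin n) → List (LexV n m)
  layer i = map (inLayer i) (allFin (m i))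

  layer-unique : ∀ i → Unique (layer i)
  layer-unique i = Unique.map⁺ layer-injective (Unique.allFin⁺ (m i))

  length-layer : ∀ i → length (layer i) ≡ m i
  length-layer i = trans (length-map (inLayer i) (allFin (m i))) (length-tabulate {n = m i} (λ z → z))

  cLayer : (i : Fin n) → Fin (m i) → Fin (m i) → List (LexV n m)
  cLayer i x y = map (inLayer i) (filterᵇ (cMember (H i) x y) (allFin (m i)))

  cLayer-unique : ∀ i x y → Unique (cLayer i x y)
  cLayer-unique i x y =
    Unique.map⁺ layer-injective (Unique.filter⁺ (T? ∘ cMember (H i) x y) (Unique.allFin⁺ (m i)))

  length-cLayer : ∀ i x y → length (cLayer i x y) ≡ cSize (H i) x y
  length-cLayer i x y = length-map (inLayer i) (filterᵇ (cMember (H i) x y) (allFin (m i)))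

  vertices : List (LexV n m)
  vertices = concat (map layer (allFin n))

  ∈-vertices : ∀ p → p ∈ vertices
  ∈-vertices (i , v) = ∈-concat⁺′ (∈-map⁺ (inLayer i) (∈-allFin v)) (∈-map⁺ layer (∈-allFin i))

  inner-adj : ∀ {i v u} → LexAdj G H (i , v) (i , u) → T (adj (H i) v u)
  inner-adj (outer e) = ⊥-elim (adj-irrefl G _ e)
  inner-adj (inner e) = e

  walk-one-across⇒adj : ∀ {i j v u} → i ≢ j → Walk L (i , v) (j , u) 1 → T (adj G i j)
  walk-one-across⇒adj _   (step (outer e) here) = e
  walk-one-across⇒adj i≢j (step (inner _) here) = ⊥-elim (i≢j refl)

  project-walk : ∀ {i j v u k} → Walk L (i , v) (j , u) k → ∃[ k′ ] k′ ≤ k × Walk (toGraph G) i j k′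
  project-walk here = 0 , z≤n , here
  project-walk (step (outer e) w) with project-walk w
  ... | k′ , k′≤k , w′ = suc k′ , s≤s k′≤k , step e w′
  project-walk (step (inner e) w) with project-walk w
  ... | k′ , k′≤k , w′ = k′ , m≤n⇒m≤1+n k′≤k , w′

  module Distances (point : ∀ i → Fin (m i)) (neighbour : ∀ i → ∃[ j ] T (adj G i j)) where

    lift-walk : ∀ {i j k} v u → Walk (toGraph G) i j (suc k) → Walk L (i , v) (j , u) (suc k)
    lift-walk v u (step e here)           = step (outer e) here
    lift-walk v u (step e w@(step _ _)) = step (outer e) (lift-walk (point _) u w)

    Dist-across : ∀ {i j d} → i ≢ j → Dist (toGraph G) i j d → ∀ v u → Dist L (i , v) (j , u) d
    Dist-across {d = zero}  i≢j (w , _)     v u = ⊥-elim (i≢j (walk-zero⇒≡ w))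
    Dist-across {i} {j} {suc d} i≢j (w , d-min) v u = lift-walk v u w , lifted-min
      where
      lifted-min : ∀ k → Walk L (i , v) (j , u) k → suc d ≤ k
      lifted-min k w′ with project-walk w′
      ... | k′ , k′≤k , wG = ≤-trans (d-min k′ wG) k′≤k

    Dist-adjacent : ∀ {i j} → i ≢ j → T (adj G i j) → ∀ v u → Dist L (i , v) (j , u) 1
    Dist-adjacent i≢j e = Dist-across i≢j (step e here , one-min)
      where
      one-min : ∀ k → Walk (toGraph G) _ _ k → 1 ≤ k
      one-min zero    w = ⊥-elim (i≢j (walk-zero⇒≡ w))
      one-min (suc _) _ = s≤s z≤n

    Dist-within : ∀ i v u → Dist L (i , v) (i , u) (innerDist (H i) v u)
    Dist-within i v u with u ≟ v
    ... | yes refl = here , λ _ _ → z≤n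
    ... | no u≢v with adj (H i) v u in v~u
    ...   | true = step (inner (subst T (sym v~u) tt)) here , one-min
      where
      one-min : ∀ k → Walk L (i , v) (i , u) k → 1 ≤ k
      one-min zero    w = ⊥-elim (u≢v (sym (layer-injective (walk-zero⇒≡ w))))
      one-min (suc _) _ = s≤s z≤n
    ...   | false = lift-walk v u (step e (step (subst T (adj-sym G i j) e) here)) , two-min
      where
      j = proj₁ (neighbour i)
      e = proj₂ (neighbour i)
      two-min : ∀ k → Walk L (i , v) (i , u) k → 2 ≤ k
      two-min zero                 w = ⊥-elim (u≢v (sym (layer-injective (walk-zero⇒≡ w))))
      two-min (suc zero) (step a here) = ⊥-elim (subst T v~u (inner-adj a))
      two-min (suc (suc _))        _ = s≤s (s≤s z≤n)

    Distinguishes-within : ∀ i {x y} u → x ≢ y → T (cMember (H i) x y u) →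
                           Distinguishes L (i , u) (i , x) (i , y)
    Distinguishes-within i {x} {y} u x≢y t a b da db a≡b =
      innerDist-≢ (H i) u x≢y t
        (trans (Dist-unique (Dist-within i x u) da) (trans a≡b (Dist-unique db (Dist-within i y u))))

    neighbour-layer-distinguishes : ∀ {i j z} → z ≢ i → z ≢ j → T (adj G i z) → ¬ T (adj G j z) →
                                    ∀ v w u → Distinguishes L (z , u) (i , v) (j , w)
    neighbour-layer-distinguishes z≢i z≢j i~z j≁z v w u a b da db a≡b =
      j≁z (walk-one-across⇒adj (z≢j ∘ sym) (subst (Walk L _ _) b≡1 (proj₁ db)))
      where
      b≡1 : b ≡ 1
      b≡1 = trans (sym a≡b) (Dist-unique da (Dist-adjacent (z≢i ∘ sym) i~z v u))

    Distinguishes-across : ∀ {i j z} → z ≢ i → z ≢ j → adj G i z ≢ adj G j z →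
                           ∀ v w u → Distinguishes L (z , u) (i , v) (j , w)
    Distinguishes-across {i} {j} {z} z≢i z≢j sep v w u with adj G i z in i~z | adj G j z in j~z
    ... | true  | false = neighbour-layer-distinguishes z≢i z≢j
                            (subst T (sym i~z) tt) (subst T j~z) v w u
    ... | false | true  = Distinguishes-sym (neighbour-layer-distinguishes z≢j z≢i
                            (subst T (sym j~z) tt) (subst T i~z) w v u)
    ... | true  | true  = ⊥-elim (sep refl)
    ... | false | false = ⊥-elim (sep refl)

    module _ (conn : Connected (toGraph G)) where

      Lex-connected : Connected L
      Lex-connected (i , v) (j , u) with i ≟ j
      ... | yes refl = _ , proj₁ (Dist-within i v u)
      ... | no i≢j with conn i j
      ...   | zero  , w = ⊥-elim (i≢j (walk-zero⇒≡ w))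
      ...   | suc k , w = suc k , lift-walk v u w

      ¬Distinguishes-across : ∀ {i j} → i ≢ j → ∀ x y u → ¬ Distinguishes L (j , u) (i , x) (i , y)
      ¬Distinguishes-across {i} {j} i≢j x y u d with Dist-exists G (proj₂ (conn i j))
      ... | dG , D = d dG dG (Dist-across i≢j D x u) (Dist-across i≢j D y u) refl

      Distinguishes⇒∈cLayer : ∀ {i x y p} → Distinguishes L p (i , x) (i , y) → p ∈ cLayer i x y
      Distinguishes⇒∈cLayer {i} {x} {y} {j , u} d with j ≟ i
      ... | no j≢i = ⊥-elim (¬Distinguishes-across (j≢i ∘ sym) x y u d)
      ... | yes refl = ∈-map⁺ (inLayer i) (∈-filter⁺ (T? ∘ cMember (H i) x y) (∈-allFin u) u∈C)
        where
        u∈C : T (cMember (H i) x y u)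
        u∈C = decidable-stable (T? _) λ u∉C →
                d _ _ (Dist-within i x u) (Dist-within i y u) (innerDist-≡ (H i) u u∉C)

module MetricDimension {n} {m : Fin n → ℕ} (G : FinGraph n) (H : (i : Fin n) → FinGraph (m i))
         (2≤n : 2 ≤ n) (conn : Connected (toGraph G)) (twin-free : TwinFree (toGraph G))
         (2≤m : ∀ i → 2 ≤ m i) where

  open LexProduct G H public

  private
    two-distinct : ∀ {k} → 2 ≤ k → Σ (Fin k) λ a → Σ (Fin k) λ b → a ≢ b
    two-distinct (s≤s (s≤s _)) = zero , suc zero , λ ()

  open Distances (proj₁ ∘ two-distinct ∘ 2≤m) (connected⇒neighbour G 2≤n conn) public

  module _ {c : ℕ} (c-min : ∀ i (x y : Fin (m i)) → x ≢ y → c ≤ cSize (H i) x y) where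

    c≤order : ∀ i → c ≤ m i
    c≤order i with two-distinct (2≤m i)
    ... | a , b , a≢b = ≤-trans (c-min i a b a≢b) (cSize≤order (H i) a b)

    resolved-by : ∀ {x y} (ws : List (LexV n m)) → Unique ws → c ≤ length ws →
                  All (λ w → Distinguishes L w x y) ws →
                  Σ (List (LexV n m)) λ ws → Unique ws × All (_∈ vertices) ws × c ≤ length ws
                                         × All (λ w → Distinguishes L w x y) ws
    resolved-by ws u len dis = ws , u , All.universal ∈-vertices ws , len , dis

    vertices-generator : IsKMetricGenerator L vertices c
    vertices-generator (i , x) (j , y) p≢q with i ≟ j
    ... | yes refl =
      resolved-by (cLayer i x y) (cLayer-unique i x y)
        (subst (c ≤_) (sym (length-cLayer i x y)) (c-min i x y x≢y))
        (All.map⁺ (All.map (Distinguishes-within i _ x≢y)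
                           (All.all-filter (T? ∘ cMember (H i) x y) (allFin (m i)))))
      where
      x≢y : x ≢ y
      x≢y = p≢q ∘ cong (inLayer i)
    ... | no i≢j with ¬Twins⇒separator G (twin-free i j i≢j)
    ...   | z , z≢i , z≢j , sep =
      resolved-by (layer z) (layer-unique z)
        (subst (c ≤_) (sym (length-layer z)) (c≤order z))
        (All.map⁺ (All.universal (Distinguishes-across z≢i z≢j sep x y) (allFin (m z))))

    no-larger-generator : (Σ (Fin n) λ i → Σ (Fin (m i)) λ x → Σ (Fin (m i)) λ y →
                             x ≢ y × cSize (H i) x y ≡ c) →
                          ∀ k′ → c < k′ → ¬ (Σ (List (LexV n m)) λ S → IsKMetricGenerator L S k′)
    no-larger-generator (i , x , y , x≢y , cSize≡c) k′ c<k′ (S , generator)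
      with generator (i , x) (i , y) (x≢y ∘ layer-injective)
    ... | ws , unique , _ , k′≤ws , dis = <-irrefl refl (≤-trans c<k′ (≤-trans k′≤ws ws≤c))
      where
      ws≤c : length ws ≤ c
      ws≤c = ≤-trans (Unique⇒length≤ unique (All.map (Distinguishes⇒∈cLayer conn) dis))
                     (≤-reflexive (trans (length-cLayer i x y) cSize≡c))

corollary6 : (n : ℕ) (m : Fin n → ℕ)
    (G : FinGraph n) (H : (i : Fin n) → FinGraph (m i)) →
    2 ≤ n → Connected (toGraph G) → TwinFree (toGraph G) →
    (∀ i → 2 ≤ m i) →
    (c : ℕ) → IsCFamily H c →
    KMetricDimensional (Lex G H) c
corollary6 n m G H 2≤n conn twin-free 2≤m c (c-attained , c-min) =
  Lex-connected conn , (vertices , vertices-generator c-min) , no-larger-generator c-min c-attained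
  where open MetricDimension G H 2≤n conn twin-free 2≤m
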